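{- Consider an execution of the algorithm $\mathtt{Follow}$ on a simple temporal graph $\mathcal{G}=(V,E,\lambda)$ with lifetime $T_{\max}$ and parameter $\delta\in\mathbb{N}^+$. Let $v$ be a node that is seed-infected at time step $t$ in some round of this execution, and let $e$ be an edge adjacent to $v$ with $\lambda(e)\in\{t+1,\dots,t+\delta\}$. Then there is a round of the execution with a successful infection via $e$ (from $v$ or to $v$).
   Context: A simple temporal graph $\mathcal{G}=(V,E,\lambda)$ with lifetime $T_{\max}$ has a finite undirected static graph $(V,E)$ and labeling $\lambda:E\to\{1,\dots,T_{\max}\}$. Infection model with parameter $\delta$: all nodes start susceptible; a seed infection $(v,t)$ makes $v$ infected at time $t$; otherwise a susceptible node $u$ becomes infected at time $t$ iff some node $w$ infectious at time $t$ has an edge $uw$ with $\lambda(uw)=t$ (if several, exactly one of them infects $u$, chosen by the Adversary); a node infected at time $t$ is infectious at times $t+1,\dots,t+\delta$ and resistant afterwards. In each round the algorithm submits a seed set and observes an infection log (triples $(u,w,s)$: $u$ infected $w$ at time $s$) of an infection chain on $\mathcal{G}$; a successful infection via edge $uw$ means such a triple appears in a log, which reveals $\lambda(uw)=s$. Subroutine $\mathtt{Explore}(u,t)$: (1) for each $t'\in\{t-\delta-1,t-1,t\}$, if no round with seed infection $(u,t')$ has been performed so far, perform a round with the single seed infection $(u,t')$ and record this; (2) for each edge $uw$ along which $u$ newly infected $w$ in these rounds, at infection time $s$, call $\mathtt{Explore}(w,s)$. Algorithm $\mathtt{Follow}$: (1) pick a node $v_0\in V$ arbitrarily; (2) for each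 $i\in\{0,1,\dots,\lceil T_{\max}/\delta\rceil\}$ perform a round with the single seed infection $(v_0,i\delta)$; (3) for each edge $e=v_0u$ along which an infection succeeded, call $\mathtt{Explore}(u,\lambda(e))$. -}

module Defs where

open import Data.Nat as ℕ using (ℕ; NonZero)
open import Data.Nat.DivMod using (_/_)
open import Data.Integer using (ℤ; +_; _-_; _+_; _<_; _≤_)
open import Data.Fin using (Fin)
open import Data.Maybe using (Maybe; just; nothing)
open import Data.Product using (_×_; ∃; Σ)
open import Data.Sum using (_⊎_)
open import Relation.Binary.PropositionalEquality using (_≡_; _≢_)

⌈_/_⌉ : (a b : ℕ) → .{{NonZero b}} → ℕ
⌈ a / b ⌉ = (a ℕ.+ b ℕ.∸ 1) / b

-- A simple temporal graph on node set V = Fin n with lifetime Tmax.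
-- lab u w ≡ just k  means: uw ∈ E and λ(uw) = k;  lab u w ≡ nothing : no edge.
record TGraph (n Tmax : ℕ) : Set where
  field
    lab       : Fin n → Fin n → Maybe ℕ
    lab-sym   : ∀ u w → lab u w ≡ lab w u
    lab-loop  : ∀ u → lab u u ≡ nothing
    lab-range : ∀ u w k → lab u w ≡ just k → 1 ℕ.≤ k × k ℕ.≤ Tmax
open TGraph public

HasLabel : ∀ {n Tmax} → TGraph n Tmax → Fin n → Fin n → ℤ → Set
HasLabel G u w t = ∃ λ k → lab G u w ≡ just k × t ≡ + k

-- it : infection times (nothing = never infected).
-- w is infectious at time t: infected at s with s+1 ≤ t ≤ s+δ.
Infectious : ∀ {n} → ℕ → (Fin n → Maybe ℤ) → Fin n → ℤ → Set
Infectious δ it w t = ∃ λ s → it w ≡ just s × s < t × t ≤ s + + δ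

Susceptible : ∀ {n} → (Fin n → Maybe ℤ) → Fin n → ℤ → Set
Susceptible it u t = ∀ s → it u ≡ just s → t ≤ s

-- An infection chain on G with parameter δ and single seed infection (v0,t0).
-- it = infection times; par = infector chosen by the Adversary.
record Chain {n Tmax} (G : TGraph n Tmax) (δ : ℕ) (v0 : Fin n) (t0 : ℤ) : Set where
  field
    it     : Fin n → Maybe ℤ
    par    : Fin n → Fin n
    seed   : it v0 ≡ just t0
    spread⇒ : ∀ u t → u ≢ v0 → it u ≡ just t →
              Susceptible it u t × ∃ λ w → Infectious δ it w t × HasLabel G u w t
    spread⇐ : ∀ u t → u ≢ v0 →
              Susceptible it u t → (∃ λ w → Infectious δ it w t × HasLabel G u w t) →
              it u ≡ just t
    par-ok : ∀ u t → u ≢ v0 → it u ≡ just t →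
             Infectious δ it (par u) t × HasLabel G u (par u) t
open Chain public

-- The infection log of a chain contains (x , y , s): x infected y at time s.
InLog : ∀ {n Tmax} {G : TGraph n Tmax} {δ : ℕ} {v0 : Fin n} {t0 : ℤ} →
        Chain G δ v0 t0 → Fin n → Fin n → ℤ → Set
InLog {v0 = v0} c x y s = y ≢ v0 × it c y ≡ just s × par c y ≡ x

-- The Adversary: the infection chain returned for the round with seed (v,t).
Adversary : ∀ {n Tmax} → TGraph n Tmax → ℕ → Set
Adversary {n} G δ = (v : Fin n) (t : ℤ) → Chain G δ v t

-- The rounds performed by an execution of Follow (start node v0, Adversary A):
-- Performed v t  means a round with single seed infection (v,t) is performed.
data Performed {n Tmax} (G : TGraph n Tmax) (δ : ℕ) .{{_ : NonZero δ}}
               (A : Adversary G δ) (v0 : Fin n) : Fin n → ℤ → Set where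
  -- step (2) of Follow
  follow  : ∀ i → i ℕ.≤ ⌈ Tmax / δ ⌉ → Performed G δ A v0 v0 (+ (i ℕ.* δ))
  -- step (3) of Follow / step (2) of Explore: u (seed of a performed round)
  -- infected w at time s, so Explore(w,s) performs rounds with seeds
  -- (w, s-δ-1), (w, s-1), (w, s)
  explore : ∀ {u t w s} → Performed G δ A v0 u t → InLog (A u t) u w s →
            ∀ t' → (t' ≡ s - + δ - + 1 ⊎ t' ≡ s - + 1 ⊎ t' ≡ s) →
            Performed G δ A v0 w t'

{-# OPTIONS --safe #-}
module Submission where

-- In the round seeded at (v, t) the neighbour w is infected by time l = λ(vw). Either v
-- infected w itself, or w descends from a node y that v infected at some s with t < s < l.
-- Then Explore(y, s) seeds y at s - 1; no one but y is infectious at time s in that round,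
-- so y infects v back at s and Explore(v, s) seeds v at s. Repeating from (v, s) shrinks the
-- gap l - t, so eventually v infects w (or w infects v) in some round.

open import Defs
open import Data.Nat using (ℕ; NonZero)
open import Data.Integer using (ℤ; +_; _+_; _<_; _≤_)
open import Data.Fin using (Fin)
open import Data.Product using (_×_; ∃; ∃-syntax)
open import Data.Sum using (_⊎_)

import Data.Nat as ℕ
open import Data.Nat.Induction using (<-wellFounded)
open import Data.Integer using (_-_; -1ℤ; pred; +<+; _≤?_) renaming (suc to sucℤ)
open import Data.Integer.Properties hiding (_≟_)
open import Data.Fin.Properties using (_≟_)
open import Data.Maybe using (Maybe; just; nothing)
open import Data.Maybe.Properties using (just-injective)
open import Data.Product using (_,_; proj₁; proj₂; ∃₂)
open import Data.Sum using (inj₁; inj₂)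
open import Data.Empty using (⊥-elim)
open import Induction.WellFounded using (Acc; acc)
open import Relation.Nullary using (yes; no)
open import Relation.Binary.PropositionalEquality

i-1≡pred[i] : ∀ i → i - + 1 ≡ pred i
i-1≡pred[i] i = +-comm i -1ℤ

i-1<i : ∀ i → i - + 1 < i
i-1<i i = subst (_< i) (sym (i-1≡pred[i] i)) (i≤pred[j]⇒i<j ≤-refl)

i-1<j⇒i≤j : ∀ {i j} → i - + 1 < j → i ≤ j
i-1<j⇒i≤j {i} {j} i-1<j = begin
  i              ≡⟨ suc-pred i ⟨
  sucℤ (pred i)  ≤⟨ i<j⇒suc[i]≤j (subst (_< j) (i-1≡pred[i] i) i-1<j) ⟩
  j              ∎
  where open ≤-Reasoning

i≤i-1+n : ∀ i n → .{{NonZero n}} → i ≤ i - + 1 + + n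
i≤i-1+n i n = i-1<j⇒i≤j (begin-strict
  i - + 1         ≡⟨ +-identityʳ (i - + 1) ⟨
  i - + 1 + + 0   <⟨ +-monoʳ-< (i - + 1) (+<+ (ℕ.>-nonZero⁻¹ n)) ⟩
  i - + 1 + + n   ∎)
  where open ≤-Reasoning

i<j⇒i+suc[n]≤j+n : ∀ {i j} → i < j → ∀ n → i + + ℕ.suc n ≤ j + + n
i<j⇒i+suc[n]≤j+n {i} {j} i<j n = begin
  i + (+ 1 + + n)  ≡⟨ +-assoc i (+ 1) (+ n) ⟨
  i + + 1 + + n    ≡⟨ cong (_+ + n) (+-comm i (+ 1)) ⟩
  sucℤ i + + n     ≤⟨ +-monoˡ-≤ (+ n) (i<j⇒suc[i]≤j i<j) ⟩
  j + + n          ∎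
  where open ≤-Reasoning

susceptible-or-infected-before : ∀ {n} (it : Fin n → Maybe ℤ) u t →
                                 Susceptible it u t ⊎ ∃ λ s → it u ≡ just s × s < t
susceptible-or-infected-before it u t with it u
... | nothing = inj₁ λ _ ()
... | just s with t ≤? s
...   | yes t≤s = inj₁ λ { _ refl → t≤s }
...   | no t≰s  = inj₂ (s , refl , ≰⇒> t≰s)

module _ {n Tmax} (G : TGraph n Tmax) where

  HasLabel-sym : ∀ {u w t} → HasLabel G u w t → HasLabel G w u t
  HasLabel-sym {u} {w} (k , labuw , t≡k) = k , trans (lab-sym G w u) labuw , t≡k

  HasLabel⇒≢ : ∀ {u w t} → HasLabel G u w t → u ≢ w
  HasLabel⇒≢ {u} (k , labuu , _) refl with trans (sym labuu) (lab-loop G u)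
  ... | ()

module _ {n Tmax} {G : TGraph n Tmax} where

  module _ {δ v0 t0} (c : Chain G δ v0 t0) where

    infection-time-natural : ∀ {u s} → u ≢ v0 → it c u ≡ just s → ∃ λ k → s ≡ + k
    infection-time-natural u≢v0 itu with proj₂ (spread⇒ c _ _ u≢v0 itu)
    ... | _ , _ , k , _ , s≡k = k , s≡k

    InLog⇒HasLabel : ∀ {x y s} → InLog c x y s → HasLabel G x y s
    InLog⇒HasLabel {y = y} {s} (y≢v0 , ity , pary) =
      HasLabel-sym G (subst (λ x → HasLabel G y x s) pary (proj₂ (par-ok c y s y≢v0 ity)))

    seed-child-later : ∀ {y s} → InLog c v0 y s → t0 < s
    seed-child-later {y} {s} (y≢v0 , ity , pary) with proj₁ (par-ok c y s y≢v0 ity)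
    ... | s' , itp , s'<s , _ = subst (_< s) (sym t0≡s') s'<s
      where
      t0≡s' : t0 ≡ s'
      t0≡s' = just-injective (trans (sym (seed c)) (trans (cong (it c) (sym pary)) itp))

    first-generation-ancestor : ∀ {u s} → u ≢ v0 → it c u ≡ just s →
                                par c u ≡ v0 ⊎ ∃₂ λ y s₁ → InLog c v0 y s₁ × s₁ < s
    first-generation-ancestor u≢v0 itu with infection-time-natural u≢v0 itu
    ... | k , refl = go (<-wellFounded k) u≢v0 itu
      where
      go : ∀ {k u} → Acc ℕ._<_ k → u ≢ v0 → it c u ≡ just (+ k) →
           par c u ≡ v0 ⊎ ∃₂ λ y s₁ → InLog c v0 y s₁ × s₁ < + k
      go {u = u} (acc rec) u≢v0 itu with par c u ≟ v0
      ... | yes p≡v0 = inj₁ p≡v0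
      ... | no p≢v0 with proj₁ (par-ok c u _ u≢v0 itu)
      ...   | s' , itp , s'<s , _ with infection-time-natural p≢v0 itp
      ...     | k' , refl with go (rec (drop‿+<+ s'<s)) p≢v0 itp
      ...       | inj₁ pp≡v0 = inj₂ (par c u , + k' , (p≢v0 , itp , pp≡v0) , s'<s)
      ...       | inj₂ (y , s₁ , log , s₁<s') = inj₂ (y , s₁ , log , <-trans s₁<s' s'<s)

    infected-after-seed : ∀ {u s} → u ≢ v0 → it c u ≡ just s → t0 < s
    infected-after-seed u≢v0 itu with first-generation-ancestor u≢v0 itu
    ... | inj₁ pu≡v0 = seed-child-later (u≢v0 , itu , pu≡v0)
    ... | inj₂ (_ , _ , log , s₁<s) = <-trans (seed-child-later log) s₁<s

    seed-neighbour-infected : ∀ {w l} → HasLabel G v0 w l → t0 < l → l ≤ t0 + + δ →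
                              ∃ λ s → it c w ≡ just s × s ≤ l
    seed-neighbour-infected {w} {l} hl t0<l l≤t0+δ
      with susceptible-or-infected-before (it c) w l
    ... | inj₂ (s , itw , s<l) = s , itw , <⇒≤ s<l
    ... | inj₁ susceptible = l , spread⇐ c w l w≢v0 susceptible infector , ≤-refl
      where
      w≢v0 = ≢-sym (HasLabel⇒≢ G hl)
      infector = v0 , (t0 , seed c , t0<l , l≤t0+δ) , HasLabel-sym G hl

  -- The seed time l - 1 leaves no other node infectious at time l.
  seed-infects-at-next-step : ∀ {δ x u l} .{{_ : NonZero δ}} (c : Chain G δ x (l - + 1)) →
                              HasLabel G x u l → InLog c x u l
  seed-infects-at-next-step {δ} {x} {u} {l} c hl
    with ≢-sym (HasLabel⇒≢ G hl) | seed-neighbour-infected c hl (i-1<i l) (i≤i-1+n l δ)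
  ... | u≢x | s , itu , s≤l
    with ≤-antisym s≤l (i-1<j⇒i≤j (infected-after-seed c u≢x itu))
  ... | refl with first-generation-ancestor c u≢x itu
  ...   | inj₁ pu≡x = u≢x , itu , pu≡x
  ...   | inj₂ (_ , _ , log , s₁<l) =
          ⊥-elim (<⇒≱ s₁<l (i-1<j⇒i≤j (seed-child-later c log)))

module _ {n Tmax} (G : TGraph n Tmax) (δ : ℕ) .{{_ : NonZero δ}}
         (A : Adversary G δ) (v0 : Fin n) where

  InfectedVia : Fin n → Fin n → Set
  InfectedVia v w = ∃[ u ] ∃[ t' ] ∃[ s ] (Performed G δ A v0 u t' ×
                      (InLog (A u t') v w s ⊎ InLog (A u t') w v s))

  returning-round : ∀ {v t y s} → Performed G δ A v0 v t → InLog (A v t) v y s →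
                    Performed G δ A v0 v s
  returning-round {v} {t} {y} {s} P log =
    explore P' (seed-infects-at-next-step (A y (s - + 1)) hl) s (inj₂ (inj₂ refl))
    where
    hl : HasLabel G y v s
    hl = HasLabel-sym G (InLog⇒HasLabel (A v t) log)

    P' : Performed G δ A v0 y (s - + 1)
    P' = explore P log (s - + 1) (inj₂ (inj₁ refl))

  edge-logged-or-later-round : ∀ {v t w l} → Performed G δ A v0 v t → HasLabel G v w l →
                               t < l → l ≤ t + + δ →
                               InfectedVia v w ⊎ ∃ λ s → Performed G δ A v0 v s × t < s × s < l
  edge-logged-or-later-round {v} {t} P hl t<l l≤t+δ
    with ≢-sym (HasLabel⇒≢ G hl) | seed-neighbour-infected (A v t) hl t<l l≤t+δ
  ... | w≢v | s , itw , s≤l with first-generation-ancestor (A v t) w≢v itw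
  ...   | inj₁ pw≡v = inj₁ (v , t , s , P , inj₁ (w≢v , itw , pw≡v))
  ...   | inj₂ (_ , s₁ , log , s₁<s) =
          inj₂ (s₁ , returning-round P log , seed-child-later (A v t) log , <-≤-trans s₁<s s≤l)

  edge-infected-within : ∀ f {v t w l} → Performed G δ A v0 v t → HasLabel G v w l →
                         t < l → l ≤ t + + δ → l ≤ t + + f → InfectedVia v w
  edge-infected-within ℕ.zero {t = t} _ _ t<l _ l≤t+0 =
    ⊥-elim (<⇒≱ t<l (subst (_ ≤_) (+-identityʳ t) l≤t+0))
  edge-infected-within (ℕ.suc f) P hl t<l l≤t+δ l≤t+f+1
    with edge-logged-or-later-round P hl t<l l≤t+δ
  ... | inj₁ logged = logged
  ... | inj₂ (s , P' , t<s , s<l) =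
        edge-infected-within f P' hl s<l
          (≤-trans l≤t+δ (+-monoˡ-≤ (+ δ) (<⇒≤ t<s)))
          (≤-trans l≤t+f+1 (i<j⇒i+suc[n]≤j+n t<s f))

lemma3 : ∀ {n Tmax} (G : TGraph n Tmax) (δ : ℕ) .{{_ : NonZero δ}}
           (A : Adversary G δ) (v0 : Fin n) (v : Fin n) (t : ℤ) →
           Performed G δ A v0 v t →
           ∀ (w : Fin n) (l : ℤ) → HasLabel G v w l → t < l → l ≤ t + + δ →
           ∃[ u ] ∃[ t' ] ∃[ s ] (Performed G δ A v0 u t' ×
             (InLog (A u t') v w s ⊎ InLog (A u t') w v s))
lemma3 G δ A v0 v t P w l hl t<l l≤t+δ = edge-infected-within G δ A v0 δ P hl t<l l≤t+δ l≤t+δ
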